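{- Let $R$ be a forward terminating path and $S$ a backward terminating path such that $\mathrm{ep}(R)=\mathrm{sp}(S)$ and $R\mathbin{;}\mathsf{L}\cap S^{\top}\mathbin{;}\mathsf{L}=\mathsf{O}$. Then $\mathrm{sp}(R\cup S)=\mathrm{sp}(R)$ and $\mathrm{ep}(R\cup S)=\mathrm{ep}(S)$.
   Context: $(B,\cup,\mathbin{;},\overline{\,\cdot\,},{}^{\top},{}^{*},\mathsf{I})$ is a Kleene relation algebra; all variables range over $B$. That is, $(B,\cup,\mathbin{;},\overline{\,\cdot\,},{}^{\top},\mathsf{I})$ is a relation algebra: $\cup$ is associative and commutative and $R=\overline{\overline{R}\cup\overline{S}}\cup\overline{\overline{R}\cup S}$; $\mathbin{;}$ is associative, $(R\cup S)\mathbin{;}T=R\mathbin{;}T\cup S\mathbin{;}T$, $R\mathbin{;}\mathsf{I}=R$; $(R^{\top})^{\top}=R$, $(R\cup S)^{\top}=R^{\top}\cup S^{\top}$, $(R\mathbin{;}S)^{\top}=S^{\top}\mathbin{;}R^{\top}$; $R^{\top}\mathbin{;}\overline{R\mathbin{;}S}\cup\overline{S}=\overline{S}$. The order is $R\subseteq S$ iff $R\cup S=S$; $R\cap S=\overline{\overline{R}\cup\overline{S}}$; $\mathsf{L}=R\cup\overline{R}$ is the greatest and $\mathsf{O}=R\cap\overline{R}$ the least element. The star satisfies $\mathsf{I}\cup R\mathbin{;}R^*\subseteq R^*$, $\mathsf{I}\cup R^*\mathbin{;}R\subseteq R^*$, $S\cup R\mathbin{;}Q\subseteq Q\Rightarrow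 R^*\mathbin{;}S\subseteq Q$, $S\cup Q\mathbin{;}R\subseteq Q\Rightarrow S\mathbin{;}R^*\subseteq Q$. Write $R^{\top*}=(R^{\top})^*$. The algebra satisfies the Tarski rule ($R\neq\mathsf{O}$ iff $\mathsf{L}\mathbin{;}R\mathbin{;}\mathsf{L}=\mathsf{L}$) and the point axiom (for every $R\neq\mathsf{O}$ there are points $p,q$ with $p\mathbin{;}q^{\top}\subseteq R$), where a point is an element $p$ with $p=p\mathbin{;}\mathsf{L}$, $p\mathbin{;}p^{\top}\subseteq\mathsf{I}$ and $\mathsf{I}\subseteq p^{\top}\mathbin{;}p$. Composition binds tighter than $\cup,\cap$; complement and converse bind tighter than composition. $R$ is univalent if $R^{\top}\mathbin{;}R\subseteq\mathsf{I}$ and injective if $R\mathbin{;}R^{\top}\subseteq\mathsf{I}$. $R$ is connected if $R\mathbin{;}\mathsf{L}\mathbin{;}R\subseteq R^*\cup R^{\top*}$; $R$ is a path if it is injective, univalent and connected. $\mathrm{sp}(R)=R\mathbin{;}\mathsf{L}\cap\overline{R^{\top}\mathbin{;}\mathsf{L}}$ and $\mathrm{ep}(R)=R^{\top}\mathbin{;}\mathsf{L}\cap\overline{R\mathbin{;}\mathsf{L}}$. A path $R$ is backward terminating if $\mathrm{sp}(R)\neq\mathsf{O}$ or $R=\mathsf{O}$; forward terminating if $\mathrm{ep}(R)\neq\mathsf{O}$ or $R=\mathsf{O}$. -}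

module Defs where

open import Level using (Level; suc; _⊔_)
open import Relation.Binary.PropositionalEquality using (_≡_)
open import Relation.Nullary using (¬_)
open import Data.Product using (Σ; _×_)
import Data.Sum

record KleeneRelationAlgebra (a : Level) : Set (suc a) where
  infixl 6 _∪_
  infixl 7 _⨾_
  infix 4 _⊆_
  infixl 6 _∩_
  infix 9 _ᵀ _* _ᵀ*
  field
    B    : Set a
    _∪_  : B → B → B
    _⨾_  : B → B → B
    ∁    : B → B
    _ᵀ   : B → B
    _*   : B → B
    I    : B

  _⊆_ : B → B → Set a
  R ⊆ S = R ∪ S ≡ S

  _∩_ : B → B → B
  R ∩ S = ∁ (∁ R ∪ ∁ S)

  field
    ∪-assoc   : ∀ R S T → (R ∪ S) ∪ T ≡ R ∪ (S ∪ T)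
    ∪-comm    : ∀ R S → R ∪ S ≡ S ∪ R
    huntington : ∀ R S → R ≡ ∁ (∁ R ∪ ∁ S) ∪ ∁ (∁ R ∪ S)
    ⨾-assoc   : ∀ R S T → (R ⨾ S) ⨾ T ≡ R ⨾ (S ⨾ T)
    ⨾-distribʳ : ∀ R S T → (R ∪ S) ⨾ T ≡ R ⨾ T ∪ S ⨾ T
    ⨾-identityʳ : ∀ R → R ⨾ I ≡ R
    ᵀ-involutive : ∀ R → (R ᵀ) ᵀ ≡ R
    ᵀ-∪       : ∀ R S → (R ∪ S) ᵀ ≡ R ᵀ ∪ S ᵀ
    ᵀ-⨾       : ∀ R S → (R ⨾ S) ᵀ ≡ S ᵀ ⨾ R ᵀ
    schröder  : ∀ R S → R ᵀ ⨾ ∁ (R ⨾ S) ∪ ∁ S ≡ ∁ S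
    star-unfoldˡ : ∀ R → I ∪ R ⨾ (R *) ⊆ R *
    star-unfoldʳ : ∀ R → I ∪ (R *) ⨾ R ⊆ R *
    star-inductˡ : ∀ R S Q → S ∪ R ⨾ Q ⊆ Q → (R *) ⨾ S ⊆ Q
    star-inductʳ : ∀ R S Q → S ∪ Q ⨾ R ⊆ Q → S ⨾ (R *) ⊆ Q

  -- greatest and least elements (independent of the chosen R by the axioms)
  L : B
  L = I ∪ ∁ I

  O : B
  O = I ∩ ∁ I

  IsPoint : B → Set a
  IsPoint p = (p ≡ p ⨾ L) × (p ⨾ p ᵀ ⊆ I) × (I ⊆ p ᵀ ⨾ p)

  field
    tarski₁ : ∀ R → ¬ (R ≡ O) → L ⨾ R ⨾ L ≡ L
    tarski₂ : ∀ R → L ⨾ R ⨾ L ≡ L → ¬ (R ≡ O)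
    point-axiom : ∀ R → ¬ (R ≡ O) →
      Σ B λ p → Σ B λ q → IsPoint p × IsPoint q × (p ⨾ q ᵀ ⊆ R)

  _ᵀ* : B → B
  R ᵀ* = (R ᵀ) *

  Univalent : B → Set a
  Univalent R = R ᵀ ⨾ R ⊆ I

  Injective : B → Set a
  Injective R = R ⨾ R ᵀ ⊆ I

  Connected : B → Set a
  Connected R = R ⨾ L ⨾ R ⊆ (R *) ∪ (R ᵀ*)

  IsPath : B → Set a
  IsPath R = Injective R × Univalent R × Connected R

  sp : B → B
  sp R = R ⨾ L ∩ ∁ (R ᵀ ⨾ L)

  ep : B → B
  ep R = R ᵀ ⨾ L ∩ ∁ (R ⨾ L)

  BackwardTerminating : B → Set a
  BackwardTerminating R = IsPath R × (¬ (sp R ≡ O) Data.Sum.⊎ (R ≡ O))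

  ForwardTerminating : B → Set a
  ForwardTerminating R = IsPath R × (¬ (ep R ≡ O) Data.Sum.⊎ (R ≡ O))

module Submission where

open import Defs
open import Level using (Level)
open import Algebra.Bundles using (CommutativeSemigroup)
open import Data.Product using (_×_; _,_)
open import Relation.Binary.PropositionalEquality
  using (_≡_; sym; trans; cong; cong₂; subst; subst₂; isEquivalence; module ≡-Reasoning)
import Algebra.Properties.CommutativeSemigroup as CommutativeSemigroupProperties

-- Only the Boolean part of the algebra matters.  With a = R⨾L, a' = Rᵀ⨾L, b = S⨾L and
-- b' = Sᵀ⨾L, sp (R ∪ S) and ep (R ∪ S) are (a ∪ b) ∖ (a' ∪ b') and (a' ∪ b') ∖ (a ∪ b).
-- The part of b outside a' ∪ b' lies in b ∖ b' = a' ∖ a ⊆ a' and outside a', so it is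
-- empty; and a ∖ a' lies outside b' because a misses b'.  Hence
-- (a ∪ b) ∖ (a' ∪ b') = a ∖ a'; exchanging the roles of R and S gives the ep-part.

module BooleanLaws {a : Level} (K : KleeneRelationAlgebra a) where
  open KleeneRelationAlgebra K
  open ≡-Reasoning

  ∪-commutativeSemigroup : CommutativeSemigroup a a
  ∪-commutativeSemigroup = record
    { isCommutativeSemigroup = record
      { isSemigroup = record
        { isMagma = record { isEquivalence = isEquivalence ; ∙-cong = cong₂ _∪_ }
        ; assoc   = ∪-assoc
        }
      ; comm = ∪-comm
      }
    }

  open CommutativeSemigroupProperties ∪-commutativeSemigroup using (interchange)

  Iᵀ≡I : I ᵀ ≡ I
  Iᵀ≡I = sym (begin
    I               ≡⟨ sym (ᵀ-involutive I) ⟩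
    (I ᵀ) ᵀ         ≡⟨ cong _ᵀ (sym (⨾-identityʳ (I ᵀ))) ⟩
    (I ᵀ ⨾ I) ᵀ     ≡⟨ ᵀ-⨾ (I ᵀ) I ⟩
    I ᵀ ⨾ (I ᵀ) ᵀ   ≡⟨ cong (I ᵀ ⨾_) (ᵀ-involutive I) ⟩
    I ᵀ ⨾ I         ≡⟨ ⨾-identityʳ (I ᵀ) ⟩
    I ᵀ             ∎)

  ⨾-identityˡ : ∀ S → I ⨾ S ≡ S
  ⨾-identityˡ S = begin
    I ⨾ S           ≡⟨ cong₂ _⨾_ (sym Iᵀ≡I) (sym (ᵀ-involutive S)) ⟩
    I ᵀ ⨾ (S ᵀ) ᵀ   ≡⟨ sym (ᵀ-⨾ (S ᵀ) I) ⟩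
    (S ᵀ ⨾ I) ᵀ     ≡⟨ cong _ᵀ (⨾-identityʳ (S ᵀ)) ⟩
    (S ᵀ) ᵀ         ≡⟨ ᵀ-involutive S ⟩
    S               ∎

  -- Idempotence is hard to get from Huntington's axiom alone; Schröder at R = I gives it.
  ∪-idem-∁ : ∀ S → ∁ S ∪ ∁ S ≡ ∁ S
  ∪-idem-∁ S = begin
    ∁ S ∪ ∁ S               ≡⟨ cong (_∪ ∁ S) (sym Iᵀ⨾∁[I⨾S]≡∁S) ⟩
    I ᵀ ⨾ ∁ (I ⨾ S) ∪ ∁ S   ≡⟨ schröder I S ⟩
    ∁ S                     ∎
    where
    Iᵀ⨾∁[I⨾S]≡∁S : I ᵀ ⨾ ∁ (I ⨾ S) ≡ ∁ S
    Iᵀ⨾∁[I⨾S]≡∁S = begin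
      I ᵀ ⨾ ∁ (I ⨾ S)   ≡⟨ cong₂ (λ u v → u ⨾ ∁ v) Iᵀ≡I (⨾-identityˡ S) ⟩
      I ⨾ ∁ S           ≡⟨ ⨾-identityˡ (∁ S) ⟩
      ∁ S               ∎

  huntington-diag : ∀ x → x ≡ ∁ (∁ x) ∪ ∁ (∁ x ∪ x)
  huntington-diag x = trans (huntington x x) (cong (λ u → ∁ u ∪ ∁ (∁ x ∪ x)) (∪-idem-∁ x))

  huntington-∁ : ∀ x → x ≡ ∁ (∁ x ∪ ∁ (∁ x)) ∪ ∁ (∁ x)
  huntington-∁ x = trans (huntington x (∁ x)) (cong (λ u → ∁ (∁ x ∪ ∁ (∁ x)) ∪ ∁ u) (∪-idem-∁ x))

  ∪-idem : ∀ x → x ∪ x ≡ x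
  ∪-idem x = begin
    x ∪ x               ≡⟨ cong₂ _∪_ (huntington-diag x) (huntington-diag x) ⟩
    (d ∪ e) ∪ (d ∪ e)   ≡⟨ interchange d e d e ⟩
    (d ∪ d) ∪ (e ∪ e)   ≡⟨ cong₂ _∪_ (∪-idem-∁ (∁ x)) (∪-idem-∁ (∁ x ∪ x)) ⟩
    d ∪ e               ≡⟨ sym (huntington-diag x) ⟩
    x                   ∎
    where
    d = ∁ (∁ x)
    e = ∁ (∁ x ∪ x)

  x∪∁[∁x∪x]≡x : ∀ x → x ∪ ∁ (∁ x ∪ x) ≡ x
  x∪∁[∁x∪x]≡x x = begin
    x ∪ e           ≡⟨ cong (_∪ e) (huntington-diag x) ⟩
    (d ∪ e) ∪ e     ≡⟨ ∪-assoc d e e ⟩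
    d ∪ (e ∪ e)     ≡⟨ cong (d ∪_) (∪-idem e) ⟩
    d ∪ e           ≡⟨ sym (huntington-diag x) ⟩
    x               ∎
    where
    d = ∁ (∁ x)
    e = ∁ (∁ x ∪ x)

  x∪∁x≡∁∁x∪∁x : ∀ x → x ∪ ∁ x ≡ ∁ (∁ x) ∪ ∁ x
  x∪∁x≡∁∁x∪∁x x = begin
    x ∪ ∁ x                   ≡⟨ cong (_∪ ∁ x) (huntington-∁ x) ⟩
    (p ∪ d) ∪ ∁ x             ≡⟨ cong (_∪ ∁ x) (∪-comm p d) ⟩
    (d ∪ p) ∪ ∁ x             ≡⟨ ∪-assoc d p (∁ x) ⟩
    d ∪ (p ∪ ∁ x)             ≡⟨ cong (d ∪_) (∪-comm p (∁ x)) ⟩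
    d ∪ (∁ x ∪ p)             ≡⟨ cong (λ u → d ∪ (∁ x ∪ ∁ u)) (∪-comm (∁ x) d) ⟩
    d ∪ (∁ x ∪ ∁ (d ∪ ∁ x))   ≡⟨ cong (d ∪_) (x∪∁[∁x∪x]≡x (∁ x)) ⟩
    d ∪ ∁ x                   ∎
    where
    d = ∁ (∁ x)
    p = ∁ (∁ x ∪ ∁ (∁ x))

  ∁[∁x∪x]≡∁[∁∁x∪∁x] : ∀ x → ∁ (∁ x ∪ x) ≡ ∁ (∁ (∁ x) ∪ ∁ x)
  ∁[∁x∪x]≡∁[∁∁x∪∁x] x = cong ∁ (trans (∪-comm (∁ x) x) (x∪∁x≡∁∁x∪∁x x))

  ∁-involutive : ∀ x → ∁ (∁ x) ≡ x
  ∁-involutive x = sym (begin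
    x                   ≡⟨ huntington-diag x ⟩
    d ∪ ∁ (∁ x ∪ x)     ≡⟨ cong (d ∪_) (∁[∁x∪x]≡∁[∁∁x∪∁x] x) ⟩
    d ∪ ∁ (d ∪ ∁ x)     ≡⟨ cong (d ∪_) (∁[∁x∪x]≡∁[∁∁x∪∁x] (∁ x)) ⟩
    d ∪ ∁ (∁ d ∪ d)     ≡⟨ x∪∁[∁x∪x]≡x d ⟩
    d                   ∎)
    where
    d = ∁ (∁ x)

  ∩-comm : ∀ x y → x ∩ y ≡ y ∩ x
  ∩-comm x y = cong ∁ (∪-comm (∁ x) (∁ y))

  ∁-∪ : ∀ x y → ∁ (x ∪ y) ≡ ∁ x ∩ ∁ y
  ∁-∪ x y = cong ∁ (sym (cong₂ _∪_ (∁-involutive x) (∁-involutive y)))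

  split-by : ∀ y x → x ≡ (x ∩ y) ∪ (x ∩ ∁ y)
  split-by y x = trans (huntington x y) (cong (λ u → x ∩ y ∪ ∁ (∁ x ∪ u)) (sym (∁-involutive y)))

  x∪∁x≡y∪∁y : ∀ x y → x ∪ ∁ x ≡ y ∪ ∁ y
  x∪∁x≡y∪∁y x y = begin
    x ∪ ∁ x                                         ≡⟨ cong₂ _∪_ (split-by y x) (split-by y (∁ x)) ⟩
    ((x ∩ y) ∪ (x ∩ ∁ y)) ∪ ((∁ x ∩ y) ∪ (∁ x ∩ ∁ y)) ≡⟨ interchange _ _ _ _ ⟩
    ((x ∩ y) ∪ (∁ x ∩ y)) ∪ ((x ∩ ∁ y) ∪ (∁ x ∩ ∁ y)) ≡⟨ cong₂ _∪_ (cong₂ _∪_ (∩-comm x y) (∩-comm (∁ x) y))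
                                                                 (cong₂ _∪_ (∩-comm x (∁ y)) (∩-comm (∁ x) (∁ y))) ⟩
    ((y ∩ x) ∪ (y ∩ ∁ x)) ∪ ((∁ y ∩ x) ∪ (∁ y ∩ ∁ x)) ≡⟨ sym (cong₂ _∪_ (split-by x y) (split-by x (∁ y))) ⟩
    y ∪ ∁ y                                         ∎

  O≡∁L : O ≡ ∁ L
  O≡∁L = cong ∁ (x∪∁x≡y∪∁y (∁ I) I)

  ∩-inverseʳ : ∀ x → x ∩ ∁ x ≡ O
  ∩-inverseʳ x = trans (cong ∁ (x∪∁x≡y∪∁y (∁ x) I)) (sym O≡∁L)

  ∪-identityʳ : ∀ x → x ∪ O ≡ x
  ∪-identityʳ x = begin
    x ∪ O             ≡⟨ cong (x ∪_) O≡∁L ⟩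
    x ∪ ∁ L           ≡⟨ cong (λ u → x ∪ ∁ u) L≡∁x∪x ⟩
    x ∪ ∁ (∁ x ∪ x)   ≡⟨ x∪∁[∁x∪x]≡x x ⟩
    x                 ∎
    where
    L≡∁x∪x : L ≡ ∁ x ∪ x
    L≡∁x∪x = trans (x∪∁x≡y∪∁y I (∁ x)) (cong (∁ x ∪_) (∁-involutive x))

  ⊆-antisym : ∀ {x y} → x ⊆ y → y ⊆ x → x ≡ y
  ⊆-antisym {x} {y} x⊆y y⊆x = trans (sym y⊆x) (trans (∪-comm y x) x⊆y)

  ⊆-trans : ∀ {x y z} → x ⊆ y → y ⊆ z → x ⊆ z
  ⊆-trans {x} {y} {z} x⊆y y⊆z = begin
    x ∪ z         ≡⟨ cong (x ∪_) (sym y⊆z) ⟩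
    x ∪ (y ∪ z)   ≡⟨ sym (∪-assoc x y z) ⟩
    (x ∪ y) ∪ z   ≡⟨ cong (_∪ z) x⊆y ⟩
    y ∪ z         ≡⟨ y⊆z ⟩
    z             ∎

  ∪-least : ∀ {x y z} → x ⊆ z → y ⊆ z → x ∪ y ⊆ z
  ∪-least {x} {y} {z} x⊆z y⊆z = trans (∪-assoc x y z) (trans (cong (x ∪_) y⊆z) x⊆z)

  x⊆x∪y : ∀ x y → x ⊆ x ∪ y
  x⊆x∪y x y = trans (sym (∪-assoc x x y)) (cong (_∪ y) (∪-idem x))

  y⊆x∪y : ∀ x y → y ⊆ x ∪ y
  y⊆x∪y x y = subst (y ⊆_) (∪-comm y x) (x⊆x∪y y x)

  O⊆x : ∀ x → O ⊆ x
  O⊆x x = trans (∪-comm O x) (∪-identityʳ x)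

  ∪-mono-⊆ : ∀ {x y u v} → x ⊆ u → y ⊆ v → x ∪ y ⊆ u ∪ v
  ∪-mono-⊆ {u = u} {v} x⊆u y⊆v = ∪-least (⊆-trans x⊆u (x⊆x∪y u v)) (⊆-trans y⊆v (y⊆x∪y u v))

  x∩y⊆x : ∀ x y → x ∩ y ⊆ x
  x∩y⊆x x y = begin
    x ∩ y ∪ x                         ≡⟨ cong (x ∩ y ∪_) (split-by y x) ⟩
    x ∩ y ∪ ((x ∩ y) ∪ (x ∩ ∁ y)) ≡⟨ sym (∪-assoc _ _ _) ⟩
    ((x ∩ y) ∪ (x ∩ y)) ∪ (x ∩ ∁ y)  ≡⟨ cong (_∪ (x ∩ ∁ y)) (∪-idem _) ⟩
    (x ∩ y) ∪ (x ∩ ∁ y)               ≡⟨ sym (split-by y x) ⟩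
    x                                 ∎

  x∩y⊆y : ∀ x y → x ∩ y ⊆ y
  x∩y⊆y x y = subst (_⊆ y) (∩-comm y x) (x∩y⊆x y x)

  ∁-antitone : ∀ {x y} → x ⊆ y → ∁ y ⊆ ∁ x
  ∁-antitone {x} {y} x⊆y = begin
    ∁ y ∪ ∁ x           ≡⟨ cong (λ u → ∁ u ∪ ∁ x) (sym x⊆y) ⟩
    ∁ (x ∪ y) ∪ ∁ x     ≡⟨ cong (_∪ ∁ x) (∁-∪ x y) ⟩
    ∁ x ∩ ∁ y ∪ ∁ x     ≡⟨ x∩y⊆x (∁ x) (∁ y) ⟩
    ∁ x                 ∎

  ∩-greatest : ∀ {x y z} → x ⊆ y → x ⊆ z → x ⊆ y ∩ z
  ∩-greatest {x} x⊆y x⊆z =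
    subst (_⊆ _) (∁-involutive x) (∁-antitone (∪-least (∁-antitone x⊆y) (∁-antitone x⊆z)))

  ⊆-∁-⇒⊆ : ∀ {x y} z → x ⊆ y → x ⊆ ∁ y → x ⊆ z
  ⊆-∁-⇒⊆ {x} {y} z x⊆y x⊆∁y =
    ⊆-trans (subst (x ⊆_) (∩-inverseʳ y) (∩-greatest x⊆y x⊆∁y)) (O⊆x z)

  ∩≡O⇒⊆∁ : ∀ {x y} → x ∩ y ≡ O → x ⊆ ∁ y
  ∩≡O⇒⊆∁ {x} {y} x∩y≡O = subst (_⊆ ∁ y) (sym (split-by y x))
    (∪-least (subst (_⊆ ∁ y) (sym x∩y≡O) (O⊆x (∁ y))) (x∩y⊆y x (∁ y)))

  ∩-distribˡ-∪-⊆ : ∀ x y z → x ∩ (y ∪ z) ⊆ (x ∩ y) ∪ (x ∩ z)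
  ∩-distribˡ-∪-⊆ x y z = subst (_⊆ (x ∩ y) ∪ (x ∩ z)) (sym (split-by y t)) (∪-mono-⊆ t∩y⊆x∩y w⊆x∩z)
    where
    t = x ∩ (y ∪ z)
    t⊆x : t ⊆ x
    t⊆x = x∩y⊆x x (y ∪ z)
    t∩y⊆x∩y : t ∩ y ⊆ x ∩ y
    t∩y⊆x∩y = ∩-greatest (⊆-trans (x∩y⊆x t y) t⊆x) (x∩y⊆y t y)
    w = t ∩ ∁ y
    w⊆y∪z : w ⊆ y ∪ z
    w⊆y∪z = ⊆-trans (x∩y⊆x t (∁ y)) (x∩y⊆y x (y ∪ z))
    w∖z⊆∁[y∪z] : w ∩ ∁ z ⊆ ∁ (y ∪ z)
    w∖z⊆∁[y∪z] = subst (w ∩ ∁ z ⊆_) (sym (∁-∪ y z))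
      (∩-greatest (⊆-trans (x∩y⊆x w (∁ z)) (x∩y⊆y t (∁ y))) (x∩y⊆y w (∁ z)))
    w⊆z : w ⊆ z
    w⊆z = subst (_⊆ z) (sym (split-by z w))
      (∪-least (x∩y⊆y w z) (⊆-∁-⇒⊆ z (⊆-trans (x∩y⊆x w (∁ z)) w⊆y∪z) w∖z⊆∁[y∪z]))
    w⊆x∩z : w ⊆ x ∩ z
    w⊆x∩z = ∩-greatest (⊆-trans (x∩y⊆x t (∁ y)) t⊆x) w⊆z

  infixl 6 _∖_
  _∖_ : B → B → B
  x ∖ y = x ∩ ∁ y

  ∪-∖-∪-glue : ∀ x x' y y' → x' ∖ x ≡ y ∖ y' → x ∩ y' ≡ O → (x ∪ y) ∖ (x' ∪ y') ≡ x ∖ x'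
  ∪-∖-∪-glue x x' y y' x'∖x≡y∖y' x∩y'≡O = ⊆-antisym lhs⊆x∖x' x∖x'⊆lhs
    where
    q = ∁ (x' ∪ y')
    q⊆∁x' : q ⊆ ∁ x'
    q⊆∁x' = ∁-antitone (x⊆x∪y x' y')
    q∩x⊆x∖x' : q ∩ x ⊆ x ∖ x'
    q∩x⊆x∖x' = ∩-greatest (x∩y⊆y q x) (⊆-trans (x∩y⊆x q x) q⊆∁x')
    q∩y⊆x' : q ∩ y ⊆ x'
    q∩y⊆x' = ⊆-trans
      (subst (q ∩ y ⊆_) (sym x'∖x≡y∖y')
        (∩-greatest (x∩y⊆y q y) (⊆-trans (x∩y⊆x q y) (∁-antitone (y⊆x∪y x' y')))))
      (x∩y⊆x x' (∁ x))
    q∩y⊆x∖x' : q ∩ y ⊆ x ∖ x'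
    q∩y⊆x∖x' = ⊆-∁-⇒⊆ _ q∩y⊆x' (⊆-trans (x∩y⊆x q y) q⊆∁x')
    lhs⊆x∖x' : (x ∪ y) ∖ (x' ∪ y') ⊆ x ∖ x'
    lhs⊆x∖x' = subst (_⊆ x ∖ x') (∩-comm q (x ∪ y))
      (⊆-trans (∩-distribˡ-∪-⊆ q x y) (∪-least q∩x⊆x∖x' q∩y⊆x∖x'))
    x∖x'⊆lhs : x ∖ x' ⊆ (x ∪ y) ∖ (x' ∪ y')
    x∖x'⊆lhs = ∩-greatest (⊆-trans (x∩y⊆x x (∁ x')) (x⊆x∪y x y))
      (subst (x ∖ x' ⊆_) (sym (∁-∪ x' y'))
        (∩-greatest (x∩y⊆y x (∁ x')) (⊆-trans (x∩y⊆x x (∁ x')) (∩≡O⇒⊆∁ x∩y'≡O))))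

  ∪-∖-∪-glue′ : ∀ x x' y y' → x' ∖ x ≡ y ∖ y' → x ∩ y' ≡ O → (x' ∪ y') ∖ (x ∪ y) ≡ y' ∖ y
  ∪-∖-∪-glue′ x x' y y' x'∖x≡y∖y' x∩y'≡O =
    subst₂ (λ u v → u ∖ v ≡ y' ∖ y) (∪-comm y' x') (∪-comm y x)
      (∪-∖-∪-glue y' y x' x (sym x'∖x≡y∖y') (trans (∩-comm y' x) x∩y'≡O))

module StartAndEndPoints {a : Level} (K : KleeneRelationAlgebra a) where
  open KleeneRelationAlgebra K
  open BooleanLaws K

  ∪ᵀ⨾L : ∀ R S → (R ∪ S) ᵀ ⨾ L ≡ R ᵀ ⨾ L ∪ S ᵀ ⨾ L
  ∪ᵀ⨾L R S = trans (cong (_⨾ L) (ᵀ-∪ R S)) (⨾-distribʳ (R ᵀ) (S ᵀ) L)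

  sp-∪ : ∀ R S → sp (R ∪ S) ≡ (R ⨾ L ∪ S ⨾ L) ∖ (R ᵀ ⨾ L ∪ S ᵀ ⨾ L)
  sp-∪ R S = cong₂ _∖_ (⨾-distribʳ R S L) (∪ᵀ⨾L R S)

  ep-∪ : ∀ R S → ep (R ∪ S) ≡ (R ᵀ ⨾ L ∪ S ᵀ ⨾ L) ∖ (R ⨾ L ∪ S ⨾ L)
  ep-∪ R S = cong₂ _∖_ (∪ᵀ⨾L R S) (⨾-distribʳ R S L)

mainTheorem6 : ∀ {a : Level} (K : KleeneRelationAlgebra a) →
    let open KleeneRelationAlgebra K in
    ∀ (R S : B) → ForwardTerminating R → BackwardTerminating S →
    ep R ≡ sp S → R ⨾ L ∩ S ᵀ ⨾ L ≡ O →
    (sp (R ∪ S) ≡ sp R) × (ep (R ∪ S) ≡ ep S)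
mainTheorem6 K R S _ _ epR≡spS R⨾L∩Sᵀ⨾L≡O =
  trans (sp-∪ R S) (∪-∖-∪-glue (R ⨾ L) (R ᵀ ⨾ L) (S ⨾ L) (S ᵀ ⨾ L) epR≡spS R⨾L∩Sᵀ⨾L≡O) ,
  trans (ep-∪ R S) (∪-∖-∪-glue′ (R ⨾ L) (R ᵀ ⨾ L) (S ⨾ L) (S ᵀ ⨾ L) epR≡spS R⨾L∩Sᵀ⨾L≡O)
  where
  open KleeneRelationAlgebra K
  open BooleanLaws K
  open StartAndEndPoints K
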